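{- For every initialized singular game $\mathcal{G}_S$ there exists a timed game $\mathcal{G}_T$ with the same set of observations such that $T(\mathcal{G}_S)$ and $T(\mathcal{G}_T)$ are bisimilar, i.e., there is a relation $R$ that witnesses $T(\mathcal{G}_S)\preceq_s T(\mathcal{G}_T)$ and whose inverse $R^{ -1}$ witnesses $T(\mathcal{G}_T)\preceq_s T(\mathcal{G}_S)$.
   Context: A simple compact constraint over a finite set $X$ of real variables is a conjunction containing, for each $x\in X$, exactly one conjunct $x\in I$ with $I$ a compact interval with rational endpoints; $\varphi(x)$ denotes that interval. An initialized singular game is a tuple $\mathcal{G}=(L_1,L_2,l_0,X,\mathit{Act},\mathit{Obs},\mathit{flow},E,\mathit{lbl})$ where $L_1,L_2$ are disjoint finite sets of locations (owned by Player 1 and Player 2 respectively), $l_0\in L_1$, $X$ is a finite set of real variables, $\mathit{Act}$ a finite set of actions, $\mathit{Obs}$ a finite set of observations, $\mathit{lbl}:L_1\cup L_2\to\mathit{Obs}$, $\mathit{flow}:(L_1\cup L_2)\times X\to\mathbb{Q}$, and $E$ is a set of edges $e=(l,a,\varphi_e,\mathit{rst}_e,l')$ with $l,l'\in L_1\cup L_2$, $a\in\mathit{Act}$, $\varphi_e$ a simple compact constraint over $X$, and $\mathit{rst}_e:X\to\mathbb{Q}\cup\{\bot\}$, such that $\mathit{flow}(l,x)\neq\mathit{flow}(l',x)$ implies $\mathit{rst}_e(x)\neq\bot$. A timed game is an initialized singular game with $\mathit{flow}(l,x)=1$ for all $l,x$ and in which every reset value $\mathit{rst}_e(x)\neq\bot$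 equals $0$. Semantics: the transition system $T(\mathcal{G})$ has configurations $Q(\mathcal{G})=(L_1\cup L_2)\times\mathbb{R}^X$, initial configuration $(l_0,\vec 0)$, moves $\mathit{Act}\times\mathbb{R}_{\ge 0}$, and a transition $(l,v)\xrightarrow{(a,t)}(l',v')$ whenever there is an edge $e=(l,a,\varphi_e,\mathit{rst}_e,l')$ such that for every $x\in X$: $v(x)+t\cdot\mathit{flow}(l,x)\in\varphi_e(x)$, and $v'(x)=\mathit{rst}_e(x)$ if $\mathit{rst}_e(x)\neq\bot$, $v'(x)=v(x)+t\cdot\mathit{flow}(l,x)$ otherwise. $Q_i(\mathcal{G})$ is the set of configurations whose location lies in $L_i$; $\mathit{lbl}$ is extended to configurations via their location. Alternating simulation: for two such games $\mathcal{G}^1,\mathcal{G}^2$ with the same observation set, a relation $R\subseteq (Q_1(\mathcal{G}^1)\times Q_1(\mathcal{G}^2))\cup(Q_2(\mathcal{G}^1)\times Q_2(\mathcal{G}^2))$ is a simulation if for every $(p,q)\in R$: (1) $\mathit{lbl}^1(p)=\mathit{lbl}^2(q)$; (2) if $p\in Q_1(\mathcal{G}^1)$, then for every move $m$ and every transition $p\xrightarrow{m}p'$ in $T(\mathcal{G}^1)$ there exist a move $m'$ and a transition $q\xrightarrow{m'}q'$ in $T(\mathcal{G}^2)$ with $(p',q')\in R$; (3) if $p\in Q_2(\mathcal{G}^1)$, then for every move $m'$ and every transition $q\xrightarrow{m'}q'$ in $T(\mathcal{G}^2)$ there exist a move $m$ and a transition $p\xrightarrow{m}p'$ in $T(\mathcal{G}^1)$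 with $(p',q')\in R$. $R$ witnesses $T(\mathcal{G}^1)\preceq_s T(\mathcal{G}^2)$ if $R$ is a simulation containing the pair of initial configurations. -}

module Defs where

open import Data.Nat using (ℕ)
open import Data.Fin using (Fin)
open import Data.Bool using (Bool; true; false)
open import Data.Maybe using (Maybe; just; nothing)
open import Data.Sum using (_⊎_; inj₁; inj₂)
open import Data.Product using (Σ; ∃; _×_; _,_)
open import Data.List using (List)
open import Data.List.Membership.Propositional using (_∈_)
open import Data.Rational as ℚ using (ℚ; 0ℚ; 1ℚ)
open import Relation.Binary.PropositionalEquality using (_≡_; _≢_)
open import Relation.Binary.Structures using (IsTotalOrder)
open import Algebra.Structures using (IsCommutativeRing)

-- The real numbers, axiomatised as a (Dedekind-)complete ordered field
-- (unique up to isomorphism), together with the canonical embedding of ℚ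
-- (a unital ring homomorphism, which is unique for any field of char 0).

record CompleteOrderedField : Set₁ where
  infixl 6 _+_
  infixl 7 _*_
  infix 4 _≤_
  field
    ℝ   : Set
    _+_ : ℝ → ℝ → ℝ
    _*_ : ℝ → ℝ → ℝ
    -_  : ℝ → ℝ
    0r  : ℝ
    1r  : ℝ
    isCommutativeRing : IsCommutativeRing _≡_ _+_ _*_ -_ 0r 1r
    0≢1     : 0r ≢ 1r
    inverse : ∀ x → x ≢ 0r → Σ ℝ λ y → x * y ≡ 1r
    _≤_ : ℝ → ℝ → Set
    isTotalOrder : IsTotalOrder _≡_ _≤_
    +-mono-≤   : ∀ {x y} z → x ≤ y → x + z ≤ y + z
    *-nonneg   : ∀ {x y} → 0r ≤ x → 0r ≤ y → 0r ≤ x * y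
    sup : (S : ℝ → Set) → Σ ℝ S → Σ ℝ (λ b → ∀ x → S x → x ≤ b) →
          Σ ℝ λ s → (∀ x → S x → x ≤ s) × (∀ b → (∀ x → S x → x ≤ b) → s ≤ b)
    ι   : ℚ → ℝ
    ι-1 : ι 1ℚ ≡ 1r
    ι-+ : ∀ p q → ι (p ℚ.+ q) ≡ ι p + ι q
    ι-* : ∀ p q → ι (p ℚ.* q) ≡ ι p * ι q

-- Syntax of initialized singular games.
-- Player-1 locations are Fin n₁, Player-2 locations are Fin n₂ (so they
-- are disjoint), variables are Fin nX, actions Fin nA, observations Fin o.

record Interval : Set where
  constructor [_,_]⟨_⟩
  field
    lo hi : ℚ
    lo≤hi : lo ℚ.≤ hi

record Edge (Loc : Set) (nX nA : ℕ) : Set where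
  field
    src   : Loc
    act   : Fin nA
    guard : Fin nX → Interval
    rst   : Fin nX → Maybe ℚ           -- nothing = ⊥ (no reset)
    tgt   : Loc

record Game (o : ℕ) : Set where
  field
    n₁ n₂ nX nA : ℕ
    l₀    : Fin n₁
    lbl   : Fin n₁ ⊎ Fin n₂ → Fin o
    flow  : Fin n₁ ⊎ Fin n₂ → Fin nX → ℚ
    edges : List (Edge (Fin n₁ ⊎ Fin n₂) nX nA)
    initialized : ∀ e → e ∈ edges → ∀ x →
      flow (Edge.src e) x ≢ flow (Edge.tgt e) x → Edge.rst e x ≢ nothing

  Loc : Set
  Loc = Fin n₁ ⊎ Fin n₂

  Var : Set
  Var = Fin nX

  Action : Set
  Action = Fin nA

IsTimed : ∀ {o} → Game o → Set
IsTimed G = (∀ l x → flow l x ≡ 1ℚ) ×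
            (∀ e → e ∈ edges → ∀ x c → Edge.rst e x ≡ just c → c ≡ 0ℚ)
  where open Game G

-- owner of a location: true = Player 1, false = Player 2
owner : ∀ {n₁ n₂} → Fin n₁ ⊎ Fin n₂ → Bool
owner (inj₁ _) = true
owner (inj₂ _) = false

module Semantics (R : CompleteOrderedField) where
  open CompleteOrderedField R

  Config : ∀ {o} → Game o → Set
  Config G = Game.Loc G × (Game.Var G → ℝ)

  initial : ∀ {o} (G : Game o) → Config G
  initial G = inj₁ (Game.l₀ G) , λ _ → 0r

  cLbl : ∀ {o} (G : Game o) → Config G → Fin o
  cLbl G (l , _) = Game.lbl G l

  cOwner : ∀ {o} (G : Game o) → Config G → Bool
  cOwner G (l , _) = owner l

  update : Maybe ℚ → ℝ → ℝ
  update (just c) _ = ι c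
  update nothing  w = w

  -- p --(a,t)--> p'   (moves are Act × ℝ≥0, hence 0 ≤ t)
  Step : ∀ {o} (G : Game o) → Config G → Game.Action G × ℝ → Config G → Set
  Step G (l , v) (a , t) (l' , v') =
    (0r ≤ t) ×
    Σ (Edge (Game.Loc G) (Game.nX G) (Game.nA G)) λ e →
      (e ∈ Game.edges G) × (Edge.src e ≡ l) × (Edge.act e ≡ a) × (Edge.tgt e ≡ l') ×
      (∀ x → let w = v x + t * ι (Game.flow G l x)
                 I = Edge.guard e x in
             (ι (Interval.lo I) ≤ w) × (w ≤ ι (Interval.hi I)) ×
             (v' x ≡ update (Edge.rst e x) w))

  IsSimulation : ∀ {o} (G₁ G₂ : Game o) → (Config G₁ → Config G₂ → Set) → Set
  IsSimulation G₁ G₂ Rel = ∀ p q → Rel p q →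
    (cOwner G₁ p ≡ cOwner G₂ q) ×
    (cLbl G₁ p ≡ cLbl G₂ q) ×
    (cOwner G₁ p ≡ true →
       ∀ m p' → Step G₁ p m p' → Σ (Game.Action G₂ × ℝ) λ m' → Σ (Config G₂) λ q' →
         Step G₂ q m' q' × Rel p' q') ×
    (cOwner G₁ p ≡ false →
       ∀ m' q' → Step G₂ q m' q' → Σ (Game.Action G₁ × ℝ) λ m → Σ (Config G₁) λ p' →
         Step G₁ p m p' × Rel p' q')

  Witnesses : ∀ {o} (G₁ G₂ : Game o) → (Config G₁ → Config G₂ → Set) → Set
  Witnesses G₁ G₂ Rel = IsSimulation G₁ G₂ Rel × Rel (initial G₁) (initial G₂)

-- A variable x of rate r is simulated by a clock y of rate 1 through the invariant
-- x = c + r·y, where the offset c (0, or the value of the reset that last hit x) is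
-- remembered in the location of the timed game. A guard c + r·y ∈ I is then the guard
-- y ∈ (I − c)/r, with the interval reversed when r < 0. The invariant survives an edge
-- because, by initialization, x keeps its rate unless it is reset, and then y is reset too.
-- Clocks of rate-0 variables are reset on entering a location, so during a delay they
-- measure the delay itself; their guard becomes the test c ∈ I plus a bound on the delay,
-- which the guard of any variable of nonzero rate supplies. When no variable moves,
-- the timed game lets no time pass.

module Submission where

open import Defs
open import Algebra.Bundles using (CommutativeRing)
import Algebra.Properties.Ring as RingProperties
open import Data.Empty using (⊥-elim)
open import Data.Fin as Fin using (Fin; zero; suc)
import Data.Fin.Properties as Fin
open import Data.Integer as ℤ using ()
import Data.Integer.Properties as ℤ
open import Data.List using (List; length; lookup; allFin; cartesianProductWith)
open import Data.List.Membership.Propositional using (_∈_)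
open import Data.List.Membership.Propositional.Properties using (∈-allFin; ∈-lookup; ∈-cartesianProductWith⁺; ∈-cartesianProductWith⁻)
import Data.List.Relation.Unary.Any as Any
open import Data.List.Relation.Unary.Any.Properties using (lookup-index)
open import Data.Maybe using (Maybe; just; nothing; fromMaybe)
open import Data.Nat as ℕ using (ℕ; zero; suc)
open import Data.Nat.Coprimality using (Coprime)
open import Data.Product using (Σ; ∃; ∃₂; _×_; _,_; proj₁; proj₂; assocˡ′; assocʳ′)
open import Data.Rational as ℚ using (ℚ; 0ℚ; 1ℚ; mkℚ)
import Data.Rational.Properties as ℚ
open import Data.Rational.Unnormalised as ℚᵘ using (mkℚᵘ; *≡*)
import Data.Rational.Unnormalised.Properties as ℚᵘ
open import Data.Sum using (_⊎_; inj₁; inj₂)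
open import Data.Sum.Properties using (inj₁-injective; inj₂-injective)
open import Function using (_∘_; flip)
open import Function.Bundles using (_⇔_; mk⇔; Equivalence)
open import Relation.Binary.Bundles using (Poset)
open import Relation.Binary.Definitions using (tri<; tri≈; tri>)
open import Relation.Binary.PropositionalEquality
import Relation.Binary.Reasoning.PartialOrder
open import Relation.Binary.Structures using (IsTotalOrder)
open import Relation.Nullary using (¬_; Dec; yes; no; ¬?)
open import Relation.Nullary.Decidable using (_×-dec_)

-- The timed game

module AffineInverse (c r : ℚ) (r≢0 : r ≢ 0ℚ) where
  instance _ = ℚ.≢-nonZero r≢0

  r⁻ : ℚ
  r⁻ = ℚ.1/ r

  c⁻ : ℚ
  c⁻ = ℚ.- (r⁻ ℚ.* c)

  r⁻-nonNeg : 0ℚ ℚ.< r → 0ℚ ℚ.≤ r⁻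
  r⁻-nonNeg r>0 = ℚ.<⇒≤ (ℚ.positive⁻¹ r⁻ {{ℚ.1/pos⇒pos r {{ℚ.positive r>0}}}})

  r⁻-nonPos : r ℚ.< 0ℚ → r⁻ ℚ.≤ 0ℚ
  r⁻-nonPos r<0 = ℚ.<⇒≤ (ℚ.negative⁻¹ r⁻ {{ℚ.1/neg⇒neg r {{ℚ.negative r<0}}}})

  invℚ : ℚ → ℚ
  invℚ u = c⁻ ℚ.+ r⁻ ℚ.* u

  invℚ-monotone : 0ℚ ℚ.< r → ∀ {u v} → u ℚ.≤ v → invℚ u ℚ.≤ invℚ v
  invℚ-monotone r>0 u≤v = ℚ.+-monoʳ-≤ c⁻ (ℚ.*-monoˡ-≤-nonNeg r⁻ {{ℚ.nonNegative (r⁻-nonNeg r>0)}} u≤v)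

  invℚ-antitone : r ℚ.< 0ℚ → ∀ {u v} → u ℚ.≤ v → invℚ v ℚ.≤ invℚ u
  invℚ-antitone r<0 u≤v = ℚ.+-monoʳ-≤ c⁻ (ℚ.*-monoˡ-≤-nonPos r⁻ {{ℚ.nonPositive (r⁻-nonPos r<0)}} u≤v)

  open Interval

  preimage : Interval → Interval
  preimage I with ℚ.<-cmp r 0ℚ
  ... | tri< r<0 _ _ = [ invℚ (hi I) , invℚ (lo I) ]⟨ invℚ-antitone r<0 (lo≤hi I) ⟩
  ... | tri≈ _ r≡0 _ = ⊥-elim (r≢0 r≡0)
  ... | tri> _ _ r>0 = [ invℚ (lo I) , invℚ (hi I) ]⟨ invℚ-monotone r>0 (lo≤hi I) ⟩

zeroRateGuard : ℚ → Interval → ℚ → Interval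
zeroRateGuard c I B with Interval.lo I ℚ.≤? c ×-dec c ℚ.≤? Interval.hi I
... | yes _ = [ 0ℚ , B ℚ.⊔ 0ℚ ]⟨ ℚ.p≤q⊔p B 0ℚ ⟩
... | no  _ = [ ℚ.- 1ℚ , ℚ.- 1ℚ ]⟨ ℚ.≤-refl ⟩   -- unsatisfiable: clocks are nonnegative

clockGuard : (r c : ℚ) → Interval → ℚ → Interval
clockGuard r c I B with r ℚ.≟ 0ℚ
... | yes _   = zeroRateGuard c I B
... | no r≢0  = AffineInverse.preimage c r r≢0 I

clockReset : Maybe ℚ → ℚ → Maybe ℚ
clockReset (just _) _ = just 0ℚ
clockReset nothing  r with r ℚ.≟ 0ℚ
... | yes _ = just 0ℚ
... | no  _ = nothing

clockReset-zero : ∀ m r {c} → clockReset m r ≡ just c → c ≡ 0ℚ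
clockReset-zero (just _) _ refl = refl
clockReset-zero nothing  r with r ℚ.≟ 0ℚ
... | yes _ = λ { refl → refl }
... | no  _ = λ ()

module _ {n₁ n₂ m : ℕ} where

  tagged : Fin n₁ ⊎ Fin n₂ → Fin m → Fin (n₁ ℕ.* m) ⊎ Fin (n₂ ℕ.* m)
  tagged (inj₁ i) j = inj₁ (Fin.combine i j)
  tagged (inj₂ i) j = inj₂ (Fin.combine i j)

  untag : Fin (n₁ ℕ.* m) ⊎ Fin (n₂ ℕ.* m) → Fin n₁ ⊎ Fin n₂
  untag (inj₁ k) = inj₁ (proj₁ (Fin.remQuot m k))
  untag (inj₂ k) = inj₂ (proj₁ (Fin.remQuot m k))

  untag-tagged : ∀ l j → untag (tagged l j) ≡ l
  untag-tagged (inj₁ i) j = cong (inj₁ ∘ proj₁) (Fin.remQuot-combine i j)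
  untag-tagged (inj₂ i) j = cong (inj₂ ∘ proj₁) (Fin.remQuot-combine i j)

  owner-tagged : ∀ l j → owner (tagged l j) ≡ owner l
  owner-tagged (inj₁ _) _ = refl
  owner-tagged (inj₂ _) _ = refl

  tagged-injective : ∀ {l l′ j j′} → tagged l j ≡ tagged l′ j′ → l ≡ l′ × j ≡ j′
  tagged-injective {inj₁ i} {inj₁ i′} {j} {j′} eq with Fin.combine-injective i j i′ j′ (inj₁-injective eq)
  ... | refl , refl = refl , refl
  tagged-injective {inj₂ i} {inj₂ i′} {j} {j′} eq with Fin.combine-injective i j i′ j′ (inj₂-injective eq)
  ... | refl , refl = refl , refl
  tagged-injective {inj₁ _} {inj₂ _} ()
  tagged-injective {inj₂ _} {inj₁ _} ()

module TimedGame {o} (GS : Game o) where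
  open Game GS

  E : ℕ
  E = length edges

  edge : Fin E → Edge Loc nX nA
  edge = lookup edges

  codes : ℕ
  codes = suc (E ℕ.* nX)

  Code : Set
  Code = Fin codes

  -- Code 0 stands for the offset 0, code 1 + (i , x) for the value edge i resets x to.
  codeValue : Code → ℚ
  codeValue zero    = 0ℚ
  codeValue (suc k) = let i , x = Fin.remQuot nX k in fromMaybe 0ℚ (Edge.rst (edge i) x)

  -- A code for every variable, packed into Fin so that locations stay finite.
  Assignment : Set
  Assignment = Fin (codes ℕ.^ nX)

  offset : Assignment → Var → ℚ
  offset J x = codeValue (Fin.finToFun J x)

  initialAssignment : Assignment
  initialAssignment = Fin.funToFin {m = nX} (λ _ → zero {E ℕ.* nX})

  offset-initial : ∀ x → offset initialAssignment x ≡ 0ℚ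
  offset-initial x = cong codeValue (Fin.finToFun-funToFin _ x)

  codeAfter : Fin E → Var → Maybe ℚ → Code → Code
  codeAfter i x (just _) _ = suc (Fin.combine i x)
  codeAfter i x nothing  k = k

  assignmentAfter : Fin E → Assignment → Assignment
  assignmentAfter i J = Fin.funToFin (λ x → codeAfter i x (Edge.rst (edge i) x) (Fin.finToFun J x))

  offset-after : ∀ i J x → offset (assignmentAfter i J) x ≡ fromMaybe (offset J x) (Edge.rst (edge i) x)
  offset-after i J x = trans (cong codeValue (Fin.finToFun-funToFin _ x)) (value-after (Edge.rst (edge i) x) refl)
    where
    value-after : ∀ m → Edge.rst (edge i) x ≡ m → codeValue (codeAfter i x m (Fin.finToFun J x)) ≡ fromMaybe (offset J x) m
    value-after (just d) rst≡d = trans (cong (λ (i , x) → fromMaybe 0ℚ (Edge.rst (edge i) x)) (Fin.remQuot-combine i x))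
                                       (cong (fromMaybe 0ℚ) rst≡d)
    value-after nothing  _     = refl

  nonzeroRate? : ∀ l → Dec (∃ λ z → flow l z ≢ 0ℚ)
  nonzeroRate? l = Fin.any? (λ z → ¬? (flow l z ℚ.≟ 0ℚ))

  delayBound : Loc → (Var → Interval) → Assignment → ℚ
  delayBound l g J with nonzeroRate? l
  ... | yes (z , r≢0) = Interval.hi (AffineInverse.preimage (offset J z) (flow l z) r≢0 (g z))
  ... | no  _         = 0ℚ

  TimedLoc : Set
  TimedLoc = Fin (n₁ ℕ.* (codes ℕ.^ nX)) ⊎ Fin (n₂ ℕ.* (codes ℕ.^ nX))

  timedGuard : Fin E → Assignment → Var → Interval
  timedGuard i J x = clockGuard (flow (Edge.src (edge i)) x) (offset J x) (Edge.guard (edge i) x)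
                                (delayBound (Edge.src (edge i)) (Edge.guard (edge i)) J)

  timedReset : Fin E → Var → Maybe ℚ
  timedReset i x = clockReset (Edge.rst (edge i) x) (flow (Edge.tgt (edge i)) x)

  timedEdge : Fin E → Assignment → Edge TimedLoc nX nA
  timedEdge i J = record
    { src   = tagged (Edge.src (edge i)) J
    ; act   = Edge.act (edge i)
    ; guard = timedGuard i J
    ; rst   = timedReset i
    ; tgt   = tagged (Edge.tgt (edge i)) (assignmentAfter i J)
    }

  timedEdges : List (Edge TimedLoc nX nA)
  timedEdges = cartesianProductWith timedEdge (allFin E) (allFin _)

  timedEdge∈ : ∀ i J → timedEdge i J ∈ timedEdges
  timedEdge∈ i J = ∈-cartesianProductWith⁺ timedEdge (∈-allFin i) (∈-allFin J)

  ∈timedEdges : ∀ {e} → e ∈ timedEdges → ∃₂ λ i J → e ≡ timedEdge i J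
  ∈timedEdges e∈ = let i , J , _ , _ , e≡ = ∈-cartesianProductWith⁻ timedEdge (allFin E) (allFin _) e∈ in i , J , e≡

  GT : Game o
  GT = record
    { n₁ = n₁ ℕ.* (codes ℕ.^ nX)
    ; n₂ = n₂ ℕ.* (codes ℕ.^ nX)
    ; nX = nX
    ; nA = nA
    ; l₀ = Fin.combine l₀ initialAssignment
    ; lbl = lbl ∘ untag
    ; flow = λ _ _ → 1ℚ
    ; edges = timedEdges
    ; initialized = λ _ _ _ 1≢1 → ⊥-elim (1≢1 refl)
    }

  flow-kept : ∀ i x → Edge.rst (edge i) x ≡ nothing → flow (Edge.tgt (edge i)) x ≡ flow (Edge.src (edge i)) x
  flow-kept i x no-reset with flow (Edge.src (edge i)) x ℚ.≟ flow (Edge.tgt (edge i)) x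
  ... | yes same   = sym same
  ... | no  differ = ⊥-elim (initialized (edge i) (∈-lookup i) x differ no-reset)

  GT-isTimed : IsTimed GT
  GT-isTimed = (λ _ _ → refl) , λ e e∈ x → resets-zero (∈timedEdges e∈) x
    where
    resets-zero : ∀ {e} → (∃₂ λ i J → e ≡ timedEdge i J) → ∀ x c → Edge.rst e x ≡ just c → c ≡ 0ℚ
    resets-zero (i , J , refl) x _ = clockReset-zero (Edge.rst (edge i) x) (flow (Edge.tgt (edge i)) x)

-- Ordered fields and the embedding of ℚ

module OrderedFieldProperties (R : CompleteOrderedField) where
  open CompleteOrderedField R renaming (+-mono-≤ to +-monoˡ-≤)

  commutativeRing : CommutativeRing _ _
  commutativeRing = record { isCommutativeRing = isCommutativeRing }

  open CommutativeRing commutativeRing public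
    using (+-assoc; +-comm; +-identityˡ; +-identityʳ; -‿inverseʳ;
           *-assoc; *-comm; *-identityˡ; *-identityʳ; zeroˡ; zeroʳ; distribˡ)
  open RingProperties (CommutativeRing.ring commutativeRing) public
    using (-‿involutive; -0#≈0#; +-inverseʳ-unique; -‿distribˡ-*; -‿distribʳ-*; x+x≈x⇒x≈0;
           \\-leftDividesˡ; //-rightDividesˡ)

  ≤-poset : Poset _ _ _
  ≤-poset = record { isPartialOrder = IsTotalOrder.isPartialOrder isTotalOrder }

  open IsTotalOrder isTotalOrder public using (total; antisym)
    renaming (refl to ≤-refl; trans to ≤-trans)

  module ≤-Reasoning = Relation.Binary.Reasoning.PartialOrder ≤-poset

  +-monoʳ-≤ : ∀ z {x y} → x ≤ y → z + x ≤ z + y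
  +-monoʳ-≤ z {x} {y} x≤y = subst₂ _≤_ (+-comm x z) (+-comm y z) (+-monoˡ-≤ z x≤y)

  +-mono-≤ : ∀ {x y u v} → x ≤ y → u ≤ v → x + u ≤ y + v
  +-mono-≤ {y = y} {u} x≤y u≤v = ≤-trans (+-monoˡ-≤ u x≤y) (+-monoʳ-≤ y u≤v)

  neg-antimono-≤ : ∀ {x y} → x ≤ y → - y ≤ - x
  neg-antimono-≤ {x} {y} x≤y = subst₂ _≤_ (\\-leftDividesˡ x (- y))
    (trans (cong (y +_) (+-comm (- x) (- y))) (\\-leftDividesˡ y (- x)))
    (+-monoˡ-≤ (- x + - y) x≤y)

  neg-nonNeg : ∀ {x} → x ≤ 0r → 0r ≤ - x
  neg-nonNeg x≤0 = subst (_≤ _) -0#≈0# (neg-antimono-≤ x≤0)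

  square-nonNeg : ∀ x → 0r ≤ x * x
  square-nonNeg x with total 0r x
  ... | inj₁ 0≤x = *-nonneg 0≤x 0≤x
  ... | inj₂ x≤0 = subst (0r ≤_) (trans (sym (-‿distribˡ-* x (- x)))
                                  (trans (cong -_ (sym (-‿distribʳ-* x x))) (-‿involutive (x * x))))
                     (*-nonneg (neg-nonNeg x≤0) (neg-nonNeg x≤0))

  0≤1 : 0r ≤ 1r
  0≤1 = subst (0r ≤_) (*-identityˡ 1r) (square-nonNeg 1r)

  1≰0 : ¬ (1r ≤ 0r)
  1≰0 1≤0 = 0≢1 (antisym 0≤1 1≤0)

  *-monoˡ-≤-nonNeg : ∀ {s x y} → 0r ≤ s → x ≤ y → s * x ≤ s * y
  *-monoˡ-≤-nonNeg {s} {x} {y} 0≤s x≤y = begin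
    s * x                  ≡⟨ +-identityˡ (s * x) ⟨
    0r + s * x             ≤⟨ +-monoˡ-≤ (s * x) (*-nonneg 0≤s 0≤y-x) ⟩
    s * (y + - x) + s * x  ≡⟨ distribˡ s (y + - x) x ⟨
    s * (y + - x + x)      ≡⟨ cong (s *_) (//-rightDividesˡ x y) ⟩
    s * y                  ∎
    where
    open ≤-Reasoning
    0≤y-x : 0r ≤ y + - x
    0≤y-x = subst (_≤ y + - x) (-‿inverseʳ x) (+-monoˡ-≤ (- x) x≤y)

  *-monoˡ-≤-nonPos : ∀ {s x y} → s ≤ 0r → x ≤ y → s * y ≤ s * x
  *-monoˡ-≤-nonPos {s} {x} {y} s≤0 x≤y =
    subst₂ _≤_ (negate y) (negate x) (neg-antimono-≤ (*-monoˡ-≤-nonNeg (neg-nonNeg s≤0) x≤y))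
    where
    negate : ∀ z → - (- s * z) ≡ s * z
    negate z = trans (-‿distribˡ-* (- s) z) (cong (_* z) (-‿involutive s))

  inverse-nonNeg : ∀ {x y} → 0r ≤ x → x * y ≡ 1r → 0r ≤ y
  inverse-nonNeg {x} {y} 0≤x xy≡1 = subst (0r ≤_) (begin
    x * (y * y)  ≡⟨ sym (*-assoc x y y) ⟩
    x * y * y    ≡⟨ cong (_* y) xy≡1 ⟩
    1r * y       ≡⟨ *-identityˡ y ⟩
    y            ∎) (*-nonneg 0≤x (square-nonNeg y))
    where open ≡-Reasoning

natℚ : ℕ → ℚ
natℚ zero    = 0ℚ
natℚ (suc k) = 1ℚ ℚ.+ natℚ k

toℚᵘ-natℚ : ∀ k → ℚ.toℚᵘ (natℚ k) ℚᵘ.≃ mkℚᵘ (ℤ.+ k) 0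
toℚᵘ-natℚ zero    = *≡* refl
toℚᵘ-natℚ (suc k) = ℚᵘ.≃-trans (ℚ.toℚᵘ-homo-+ 1ℚ (natℚ k))
  (ℚᵘ.≃-trans (ℚᵘ.+-congʳ ℚᵘ.1ℚᵘ (toℚᵘ-natℚ k))
              (*≡* (cong (λ i → (ℤ.+ 1 ℤ.+ i) ℤ.* ℤ.+ 1) (ℤ.*-identityʳ (ℤ.+ k)))))

mkℚ-*-denominator : ∀ n d .(c : Coprime n (suc d)) → mkℚ (ℤ.+ n) d c ℚ.* natℚ (suc d) ≡ natℚ n
mkℚ-*-denominator n d c = ℚ.toℚᵘ-injective (ℚᵘ.≃-trans (ℚ.toℚᵘ-homo-* q (natℚ (suc d)))
  (ℚᵘ.≃-trans (ℚᵘ.*-congˡ {mkℚᵘ (ℤ.+ n) d} (toℚᵘ-natℚ (suc d)))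
  (ℚᵘ.≃-trans (*≡* (ℤ.*-assoc (ℤ.+ n) (ℤ.+ suc d) (ℤ.+ 1)))
  (ℚᵘ.≃-sym (toℚᵘ-natℚ n)))))
  where q = mkℚ (ℤ.+ n) d c

module EmbeddingProperties (R : CompleteOrderedField) where
  open CompleteOrderedField R renaming (+-mono-≤ to +-monoˡ-≤)
  open OrderedFieldProperties R
  open RingProperties ℚ.+-*-ring using (x∙y⁻¹≈ε⇒x≈y)
  open ≡-Reasoning

  ι-0 : ι 0ℚ ≡ 0r
  ι-0 = x+x≈x⇒x≈0 (ι 0ℚ) (sym (ι-+ 0ℚ 0ℚ))

  ι-neg : ∀ q → ι (ℚ.- q) ≡ - ι q
  ι-neg q = +-inverseʳ-unique (ι q) (ι (ℚ.- q))
    (trans (sym (ι-+ q (ℚ.- q))) (trans (cong ι (ℚ.+-inverseʳ q)) ι-0))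

  ι-natℚ-nonNeg : ∀ k → 0r ≤ ι (natℚ k)
  ι-natℚ-nonNeg zero    = subst (0r ≤_) (sym ι-0) ≤-refl
  ι-natℚ-nonNeg (suc k) = subst₂ _≤_ (+-identityˡ 0r) (trans (cong (_+ _) (sym ι-1)) (sym (ι-+ 1ℚ (natℚ k))))
    (+-mono-≤ 0≤1 (ι-natℚ-nonNeg k))

  1+nonNeg≢0 : ∀ {x} → 0r ≤ x → 1r + x ≢ 0r
  1+nonNeg≢0 {x} 0≤x 1+x≡0 = 1≰0 (subst₂ _≤_ (+-identityʳ 1r) 1+x≡0 (+-monoʳ-≤ 1r 0≤x))

  ι-nonNeg : ∀ {q} → 0ℚ ℚ.≤ q → 0r ≤ ι q
  ι-nonNeg {mkℚ (ℤ.+ n) d c} _ =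
    subst (0r ≤_) ιq≡n*y (*-nonneg (ι-natℚ-nonNeg n) (inverse-nonNeg (ι-natℚ-nonNeg (suc d)) m*y≡1))
    where
    q = mkℚ (ℤ.+ n) d c
    m = natℚ (suc d)
    ιm≢0 : ι m ≢ 0r
    ιm≢0 = subst (_≢ 0r) (trans (cong (_+ _) (sym ι-1)) (sym (ι-+ 1ℚ (natℚ d)))) (1+nonNeg≢0 (ι-natℚ-nonNeg d))
    y = proj₁ (inverse (ι m) ιm≢0)
    m*y≡1 : ι m * y ≡ 1r
    m*y≡1 = proj₂ (inverse (ι m) ιm≢0)
    ιq≡n*y : ι (natℚ n) * y ≡ ι q
    ιq≡n*y = begin
      ι (natℚ n) * y      ≡⟨ cong (λ k → ι k * y) (mkℚ-*-denominator n d c) ⟨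
      ι (q ℚ.* m) * y     ≡⟨ cong (_* y) (ι-* q m) ⟩
      ι q * ι m * y       ≡⟨ *-assoc (ι q) (ι m) y ⟩
      ι q * (ι m * y)     ≡⟨ cong (ι q *_) m*y≡1 ⟩
      ι q * 1r            ≡⟨ *-identityʳ (ι q) ⟩
      ι q                 ∎
  ι-nonNeg {mkℚ ℤ.-[1+ n ] d c} (ℚ.*≤* ())

  ι-mono-≤ : ∀ {p q} → p ℚ.≤ q → ι p ≤ ι q
  ι-mono-≤ {p} {q} p≤q = subst₂ _≤_ (+-identityˡ (ι p)) ιq-ιp+ιp (+-monoˡ-≤ (ι p) 0≤ιq-ιp)
    where
    0≤ιq-ιp : 0r ≤ ι q + - ι p
    0≤ιq-ιp = subst (0r ≤_) (trans (ι-+ q (ℚ.- p)) (cong (ι q +_) (ι-neg p)))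
      (ι-nonNeg (subst (ℚ._≤ q ℚ.- p) (ℚ.+-inverseʳ p) (ℚ.+-monoˡ-≤ (ℚ.- p) p≤q)))
    ιq-ιp+ιp : ι q + - ι p + ι p ≡ ι q
    ιq-ιp+ιp = //-rightDividesˡ (ι p) (ι q)

  ι-nonZero : ∀ {r} → r ≢ 0ℚ → ι r ≢ 0r
  ι-nonZero {r} r≢0 ιr≡0 = 0≢1 (begin
    0r                  ≡⟨ zeroˡ (ι (ℚ.1/ r)) ⟨
    0r * ι (ℚ.1/ r)     ≡⟨ cong (_* ι (ℚ.1/ r)) ιr≡0 ⟨
    ι r * ι (ℚ.1/ r)    ≡⟨ ι-* r (ℚ.1/ r) ⟨
    ι (r ℚ.* ℚ.1/ r)    ≡⟨ cong ι (ℚ.*-inverseʳ r) ⟩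
    ι 1ℚ                ≡⟨ ι-1 ⟩
    1r                  ∎)
    where instance _ = ℚ.≢-nonZero r≢0

  ι-injective : ∀ {p q} → ι p ≡ ι q → p ≡ q
  ι-injective {p} {q} ιp≡ιq with p ℚ.- q ℚ.≟ 0ℚ
  ... | yes p-q≡0 = x∙y⁻¹≈ε⇒x≈y p q p-q≡0
  ... | no  p-q≢0 = ⊥-elim (ι-nonZero p-q≢0 (begin
    ι (p ℚ.- q)     ≡⟨ ι-+ p (ℚ.- q) ⟩
    ι p + ι (ℚ.- q) ≡⟨ cong₂ _+_ ιp≡ιq (ι-neg q) ⟩
    ι q + - ι q     ≡⟨ -‿inverseʳ (ι q) ⟩
    0r              ∎))

  ι-cancel-≤ : ∀ {p q} → ι p ≤ ι q → p ℚ.≤ q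
  ι-cancel-≤ {p} {q} ιp≤ιq with ℚ.≤-total p q
  ... | inj₁ p≤q = p≤q
  ... | inj₂ q≤p = ℚ.≤-reflexive (ι-injective (antisym ιp≤ιq (ι-mono-≤ q≤p)))

-- Affine maps and clock guards over the reals

module AffineMaps (R : CompleteOrderedField) where
  open CompleteOrderedField R renaming (+-mono-≤ to +-monoˡ-≤)
  open OrderedFieldProperties R
  open EmbeddingProperties R
  open ≡-Reasoning

  affine : ℚ → ℚ → ℝ → ℝ
  affine c r y = ι c + ι r * y

  affine-∘ : ∀ c r c′ r′ y → affine c r (affine c′ r′ y) ≡ affine (c ℚ.+ r ℚ.* c′) (r ℚ.* r′) y
  affine-∘ c r c′ r′ y = begin
    ι c + ι r * (ι c′ + ι r′ * y)            ≡⟨ cong (ι c +_) (distribˡ (ι r) (ι c′) (ι r′ * y)) ⟩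
    ι c + (ι r * ι c′ + ι r * (ι r′ * y))    ≡⟨ +-assoc (ι c) (ι r * ι c′) (ι r * (ι r′ * y)) ⟨
    ι c + ι r * ι c′ + ι r * (ι r′ * y)      ≡⟨ cong₂ _+_ (cong (ι c +_) (ι-* r c′)) (*-assoc (ι r) (ι r′) y) ⟨
    ι c + ι (r ℚ.* c′) + ι r * ι r′ * y      ≡⟨ cong₂ _+_ (ι-+ c (r ℚ.* c′)) (cong (_* y) (ι-* r r′)) ⟨
    ι (c ℚ.+ r ℚ.* c′) + ι (r ℚ.* r′) * y    ∎

  affine-ι : ∀ c r u → affine c r (ι u) ≡ ι (c ℚ.+ r ℚ.* u)
  affine-ι c r u = sym (trans (ι-+ c (r ℚ.* u)) (cong (ι c +_) (ι-* r u)))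

  affine-id : ∀ y → affine 0ℚ 1ℚ y ≡ y
  affine-id y = trans (cong₂ _+_ ι-0 (cong (_* y) ι-1)) (trans (+-identityˡ _) (*-identityˡ y))

  affine-const : ∀ c y → affine c 0ℚ y ≡ ι c
  affine-const c y = trans (cong (λ z → ι c + z * y) ι-0) (trans (cong (ι c +_) (zeroˡ y)) (+-identityʳ (ι c)))

  affine-origin : ∀ c r → affine c r 0r ≡ ι c
  affine-origin c r = trans (cong (ι c +_) (zeroʳ (ι r))) (+-identityʳ (ι c))

  affine-delay : ∀ c r y t → affine c r y + t * ι r ≡ affine c r (y + t)
  affine-delay c r y t = begin
    ι c + ι r * y + t * ι r        ≡⟨ +-assoc (ι c) (ι r * y) (t * ι r) ⟩
    ι c + (ι r * y + t * ι r)      ≡⟨ cong (λ z → ι c + (ι r * y + z)) (*-comm t (ι r)) ⟩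
    ι c + (ι r * y + ι r * t)      ≡⟨ cong (ι c +_) (distribˡ (ι r) y t) ⟨
    ι c + ι r * (y + t)            ∎

  affine-monotone : ∀ c {r y y′} → 0ℚ ℚ.≤ r → y ≤ y′ → affine c r y ≤ affine c r y′
  affine-monotone c 0≤r y≤y′ = +-monoʳ-≤ (ι c) (*-monoˡ-≤-nonNeg (subst (_≤ _) ι-0 (ι-mono-≤ 0≤r)) y≤y′)

  affine-antitone : ∀ c {r y y′} → r ℚ.≤ 0ℚ → y ≤ y′ → affine c r y′ ≤ affine c r y
  affine-antitone c r≤0 y≤y′ = +-monoʳ-≤ (ι c) (*-monoˡ-≤-nonPos (subst (_ ≤_) ι-0 (ι-mono-≤ r≤0)) y≤y′)

  infix 4 _∈[_,_] _∈ᴵ_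

  _∈[_,_] : ℝ → ℝ → ℝ → Set
  y ∈[ a , b ] = a ≤ y × y ≤ b

  _∈ᴵ_ : ℝ → Interval → Set
  y ∈ᴵ I = y ∈[ ι (Interval.lo I) , ι (Interval.hi I) ]

  module _ {f g : ℝ → ℝ} (g∘f : ∀ y → g (f y) ≡ y) (f∘g : ∀ y → f (g y) ≡ y) where

    ∈-preimage-increasing : (∀ {x y} → x ≤ y → f x ≤ f y) → (∀ {x y} → x ≤ y → g x ≤ g y) →
                            ∀ a b y → f y ∈[ a , b ] ⇔ y ∈[ g a , g b ]
    ∈-preimage-increasing f-mono g-mono a b y = mk⇔
      (λ (a≤fy , fy≤b) → subst (g a ≤_) (g∘f y) (g-mono a≤fy) , subst (_≤ g b) (g∘f y) (g-mono fy≤b))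
      (λ (ga≤y , y≤gb) → subst (_≤ f y) (f∘g a) (f-mono ga≤y) , subst (f y ≤_) (f∘g b) (f-mono y≤gb))

    ∈-preimage-decreasing : (∀ {x y} → x ≤ y → f y ≤ f x) → (∀ {x y} → x ≤ y → g y ≤ g x) →
                            ∀ a b y → f y ∈[ a , b ] ⇔ y ∈[ g b , g a ]
    ∈-preimage-decreasing f-anti g-anti a b y = mk⇔
      (λ (a≤fy , fy≤b) → subst (g b ≤_) (g∘f y) (g-anti fy≤b) , subst (_≤ g a) (g∘f y) (g-anti a≤fy))
      (λ (gb≤y , y≤ga) → subst (_≤ f y) (f∘g a) (f-anti y≤ga) , subst (f y ≤_) (f∘g b) (f-anti gb≤y))

  module _ (c r : ℚ) (r≢0 : r ≢ 0ℚ) where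
    open AffineInverse c r r≢0
    open Interval
    instance _ = ℚ.≢-nonZero r≢0

    affine-inverseˡ : ∀ y → affine c⁻ r⁻ (affine c r y) ≡ y
    affine-inverseˡ y = begin
      affine c⁻ r⁻ (affine c r y)               ≡⟨ affine-∘ c⁻ r⁻ c r y ⟩
      affine (c⁻ ℚ.+ r⁻ ℚ.* c) (r⁻ ℚ.* r) y     ≡⟨ cong₂ (λ c′ r′ → affine c′ r′ y)
                                                          (ℚ.+-inverseˡ (r⁻ ℚ.* c)) (ℚ.*-inverseˡ r) ⟩
      affine 0ℚ 1ℚ y                            ≡⟨ affine-id y ⟩
      y                                         ∎

    affine-inverseʳ : ∀ y → affine c r (affine c⁻ r⁻ y) ≡ y
    affine-inverseʳ y = begin
      affine c r (affine c⁻ r⁻ y)               ≡⟨ affine-∘ c r c⁻ r⁻ y ⟩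
      affine (c ℚ.+ r ℚ.* c⁻) (r ℚ.* r⁻) y      ≡⟨ cong₂ (λ c′ r′ → affine c′ r′ y) c+r*c⁻≡0 (ℚ.*-inverseʳ r) ⟩
      affine 0ℚ 1ℚ y                            ≡⟨ affine-id y ⟩
      y                                         ∎
      where
      c+r*c⁻≡0 : c ℚ.+ r ℚ.* c⁻ ≡ 0ℚ
      c+r*c⁻≡0 = begin
        c ℚ.+ r ℚ.* ℚ.- (r⁻ ℚ.* c)       ≡⟨ cong (c ℚ.+_) (ℚ.neg-distribʳ-* r (r⁻ ℚ.* c)) ⟨
        c ℚ.+ ℚ.- (r ℚ.* (r⁻ ℚ.* c))     ≡⟨ cong (λ z → c ℚ.+ ℚ.- z) (ℚ.*-assoc r r⁻ c) ⟨
        c ℚ.+ ℚ.- (r ℚ.* r⁻ ℚ.* c)       ≡⟨ cong (λ z → c ℚ.+ ℚ.- (z ℚ.* c)) (ℚ.*-inverseʳ r) ⟩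
        c ℚ.+ ℚ.- (1ℚ ℚ.* c)             ≡⟨ cong (λ z → c ℚ.+ ℚ.- z) (ℚ.*-identityˡ c) ⟩
        c ℚ.+ ℚ.- c                      ≡⟨ ℚ.+-inverseʳ c ⟩
        0ℚ                               ∎

    ∈-affinePreimage : ∀ I y → affine c r y ∈ᴵ I ⇔ y ∈ᴵ preimage I
    ∈-affinePreimage I y with ℚ.<-cmp r 0ℚ
    ... | tri< r<0 _ _ = subst₂ (λ a b → affine c r y ∈ᴵ I ⇔ y ∈[ a , b ]) (affine-ι c⁻ r⁻ (hi I)) (affine-ι c⁻ r⁻ (lo I))
      (∈-preimage-decreasing affine-inverseˡ affine-inverseʳ
        (affine-antitone c (ℚ.<⇒≤ r<0)) (affine-antitone c⁻ (r⁻-nonPos r<0)) _ _ y)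
    ... | tri≈ _ r≡0 _ = ⊥-elim (r≢0 r≡0)
    ... | tri> _ _ r>0 = subst₂ (λ a b → affine c r y ∈ᴵ I ⇔ y ∈[ a , b ]) (affine-ι c⁻ r⁻ (lo I)) (affine-ι c⁻ r⁻ (hi I))
      (∈-preimage-increasing affine-inverseˡ affine-inverseʳ
        (affine-monotone c (ℚ.<⇒≤ r>0)) (affine-monotone c⁻ (r⁻-nonNeg r>0)) _ _ y)

  zeroRateGuard-sound : ∀ c I B {y} → 0r ≤ y → y ∈ᴵ zeroRateGuard c I B → ι c ∈ᴵ I
  zeroRateGuard-sound c I B 0≤y y∈G with Interval.lo I ℚ.≤? c ×-dec c ℚ.≤? Interval.hi I
  ... | yes (lo≤c , c≤hi) = ι-mono-≤ lo≤c , ι-mono-≤ c≤hi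
  ... | no  _             = ⊥-elim (0≰-1 (ι-cancel-≤ (subst (_≤ _) (sym ι-0) (≤-trans 0≤y (proj₂ y∈G)))))

    where
    0≰-1 : ¬ (0ℚ ℚ.≤ ℚ.- 1ℚ)
    0≰-1 (ℚ.*≤* ())

  zeroRateGuard-complete : ∀ c I B {y} → ι c ∈ᴵ I → y ∈[ 0r , ι B ] → y ∈ᴵ zeroRateGuard c I B
  zeroRateGuard-complete c I B (ιlo≤ιc , ιc≤ιhi) (0≤y , y≤B) with Interval.lo I ℚ.≤? c ×-dec c ℚ.≤? Interval.hi I
  ... | yes _     = subst (_≤ _) (sym ι-0) 0≤y , ≤-trans y≤B (ι-mono-≤ (ℚ.p≤p⊔q B 0ℚ))
  ... | no  c∉I   = ⊥-elim (c∉I (ι-cancel-≤ ιlo≤ιc , ι-cancel-≤ ιc≤ιhi))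

  clockGuard-sound : ∀ r c I B {y} → 0r ≤ y → y ∈ᴵ clockGuard r c I B → affine c r y ∈ᴵ I
  clockGuard-sound r c I B {y} 0≤y y∈G with r ℚ.≟ 0ℚ
  ... | yes refl = subst (_∈ᴵ I) (sym (affine-const c y)) (zeroRateGuard-sound c I B 0≤y y∈G)
  ... | no  r≢0  = Equivalence.from (∈-affinePreimage c r r≢0 I y) y∈G

  clockGuard-complete : ∀ r c I B {y} → affine c r y ∈ᴵ I → (r ≡ 0ℚ → y ∈[ 0r , ι B ]) →
                        y ∈ᴵ clockGuard r c I B
  clockGuard-complete r c I B {y} fy∈I bounded with r ℚ.≟ 0ℚ
  ... | yes refl = zeroRateGuard-complete c I B (subst (_∈ᴵ I) (affine-const c y) fy∈I) (bounded refl)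
  ... | no  r≢0  = Equivalence.to (∈-affinePreimage c r r≢0 I y) fy∈I

-- Correctness of the construction

module ClockTracking (R : CompleteOrderedField) where
  open CompleteOrderedField R renaming (+-mono-≤ to +-monoˡ-≤)
  open OrderedFieldProperties R
  open EmbeddingProperties R
  open AffineMaps R
  open Semantics R using (update)

  record Tracks (r c : ℚ) (v w : ℝ) : Set where
    field
      value        : v ≡ affine c r w
      clock-nonNeg : 0r ≤ w
      clock-idle   : r ≡ 0ℚ → w ≡ 0r

  *-ι1 : ∀ t → t * ι 1ℚ ≡ t
  *-ι1 t = trans (cong (t *_) ι-1) (*-identityʳ t)

  delayed-nonNeg : ∀ {w t} → 0r ≤ w → 0r ≤ t → 0r ≤ w + t * ι 1ℚ
  delayed-nonNeg {w} {t} 0≤w 0≤t = subst₂ _≤_ (+-identityˡ 0r) (cong (w +_) (sym (*-ι1 t))) (+-mono-≤ 0≤w 0≤t)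

  t≤delayed : ∀ {w t} → 0r ≤ w → t ≤ w + t * ι 1ℚ
  t≤delayed {w} {t} 0≤w = subst₂ _≤_ (+-identityˡ t) (cong (w +_) (sym (*-ι1 t))) (+-monoˡ-≤ t 0≤w)

  idle-delayed : ∀ {w} t → w ≡ 0r → w + t * ι 1ℚ ≡ t
  idle-delayed t refl = trans (+-identityˡ _) (*-ι1 t)

  Tracks-delay : ∀ {r c v w} t {t′} → Tracks r c v w → (r ≢ 0ℚ → t′ ≡ t) →
                 v + t * ι r ≡ affine c r (w + t′ * ι 1ℚ)
  Tracks-delay {r} {c} {v} {w} t {t′} tr moving⇒t′≡t with r ℚ.≟ 0ℚ
  ... | yes refl = begin
    v + t * ι 0ℚ                    ≡⟨ cong (λ z → v + t * z) ι-0 ⟩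
    v + t * 0r                      ≡⟨ cong (v +_) (zeroʳ t) ⟩
    v + 0r                          ≡⟨ +-identityʳ v ⟩
    v                               ≡⟨ Tracks.value tr ⟩
    affine c 0ℚ w                   ≡⟨ affine-const c w ⟩
    ι c                             ≡⟨ affine-const c _ ⟨
    affine c 0ℚ (w + t′ * ι 1ℚ)     ∎
    where open ≡-Reasoning
  ... | no r≢0 rewrite moving⇒t′≡t r≢0 | *-ι1 t =
    trans (cong (_+ t * ι r) (Tracks.value tr)) (affine-delay c r w t)

  retrack : ∀ {r c c′ v v′ w w′} → c ≡ c′ → v ≡ v′ → w ≡ w′ → Tracks r c v w → Tracks r c′ v′ w′
  retrack refl refl refl tr = tr

  Tracks-reset : ∀ r c → Tracks r c (ι c) (ι 0ℚ)
  Tracks-reset r c = record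
    { value        = sym (trans (cong (affine c r) ι-0) (affine-origin c r))
    ; clock-nonNeg = subst (0r ≤_) (sym ι-0) ≤-refl
    ; clock-idle   = λ _ → ι-0
    }

  Tracks-jump : ∀ m {r r′ c V W} → (m ≡ nothing → r′ ≡ r) → V ≡ affine c r W → 0r ≤ W →
                Tracks r′ (fromMaybe c m) (update m V) (update (clockReset m r′) W)
  Tracks-jump (just d) {r′ = r′} _ _ _ = Tracks-reset r′ d
  Tracks-jump nothing {r} {c = c} {W = W} keeps V≡fW 0≤W rewrite keeps refl with r ℚ.≟ 0ℚ
  ... | yes refl = subst (λ v → Tracks 0ℚ c v (ι 0ℚ)) (sym (trans V≡fW (affine-const c W))) (Tracks-reset 0ℚ c)
  ... | no r≢0 = record
    { value        = V≡fW
    ; clock-nonNeg = 0≤W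
    ; clock-idle   = ⊥-elim ∘ r≢0
    }

module Bisimulation (R : CompleteOrderedField) {o} (GS : Game o) where
  open CompleteOrderedField R renaming (+-mono-≤ to +-monoˡ-≤)
  open OrderedFieldProperties R
  open EmbeddingProperties R
  open AffineMaps R
  open ClockTracking R
  open Semantics R
  open Game GS
  open TimedGame GS

  Rel : Config GS → Config GT → Set
  Rel (l , v) (L , w) = Σ Assignment λ J → L ≡ tagged l J × (∀ x → Tracks (flow l x) (offset J x) (v x) (w x))

  DelayMatches : Loc → Assignment → (Var → ℝ) → (Var → ℝ) → ℝ → ℝ → Set
  DelayMatches l J v w t t′ = ∀ x → v x + t * ι (flow l x) ≡ affine (offset J x) (flow l x) (w x + t′ * ι 1ℚ)

  module _ (l : Loc) (g : Var → Interval) (J : Assignment) {v w : Var → ℝ}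
           (tracks : ∀ x → Tracks (flow l x) (offset J x) (v x) (w x)) where

    ClockGuardsHold : ℚ → ℝ → Set
    ClockGuardsHold B t′ = ∀ x → w x + t′ * ι 1ℚ ∈ᴵ clockGuard (flow l x) (offset J x) (g x) B

    delay-within-bound : ∀ B {t t′} → (∀ x → v x + t * ι (flow l x) ∈ᴵ g x) → 0r ≤ t′ → t′ ≤ ι B →
                         (∀ x → flow l x ≢ 0ℚ → t′ ≡ t) → ClockGuardsHold B t′ × DelayMatches l J v w t t′
    delay-within-bound B {t} {t′} holds 0≤t′ t′≤B moving⇒t′≡t =
      (λ x → clockGuard-complete _ _ _ B (subst (_∈ᴵ g x) (matches x) (holds x)) (bounded x)) , matches
      where
      matches : DelayMatches l J v w t t′
      matches x = Tracks-delay t (tracks x) (moving⇒t′≡t x)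
      bounded : ∀ x → flow l x ≡ 0ℚ → w x + t′ * ι 1ℚ ∈[ 0r , ι B ]
      bounded x rx≡0 rewrite idle-delayed t′ (Tracks.clock-idle (tracks x) rx≡0) = 0≤t′ , t′≤B

    source-delay⇒timed-delay : ∀ {t} → 0r ≤ t → (∀ x → v x + t * ι (flow l x) ∈ᴵ g x) →
                               Σ ℝ λ t′ → 0r ≤ t′ × ClockGuardsHold (delayBound l g J) t′ × DelayMatches l J v w t t′
    source-delay⇒timed-delay {t} 0≤t holds with nonzeroRate? l
    ... | yes (z , rz≢0) = t , 0≤t , delay-within-bound _ holds 0≤t t≤bound (λ _ _ → refl)
      where
      t≤bound : t ≤ ι (Interval.hi (AffineInverse.preimage (offset J z) (flow l z) rz≢0 (g z)))
      t≤bound = ≤-trans (t≤delayed (Tracks.clock-nonNeg (tracks z)))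
        (proj₂ (Equivalence.to (∈-affinePreimage _ _ rz≢0 (g z) _)
                               (subst (_∈ᴵ g z) (Tracks-delay t (tracks z) (λ _ → refl)) (holds z))))
    ... | no all-zero = 0r , ≤-refl , delay-within-bound 0ℚ holds ≤-refl (subst (0r ≤_) (sym ι-0) ≤-refl)
                                        (λ x rx≢0 → ⊥-elim (all-zero (x , rx≢0)))

    timed-delay⇒source-delay : ∀ B {t′} → 0r ≤ t′ → ClockGuardsHold B t′ →
                               (∀ x → v x + t′ * ι (flow l x) ∈ᴵ g x) × DelayMatches l J v w t′ t′
    timed-delay⇒source-delay B {t′} 0≤t′ holds = (λ x → subst (_∈ᴵ g x) (sym (matches x))
        (clockGuard-sound _ _ _ B (delayed-nonNeg (Tracks.clock-nonNeg (tracks x)) 0≤t′) (holds x))) , matches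
      where
      matches : DelayMatches l J v w t′ t′
      matches x = Tracks-delay t′ (tracks x) (λ _ → refl)

  related-after-edge : ∀ i J {v w t t′ v′ w′} → (∀ x → 0r ≤ w x) → 0r ≤ t′ →
         DelayMatches (Edge.src (edge i)) J v w t t′ →
         (∀ x → v′ x ≡ update (Edge.rst (edge i) x) (v x + t * ι (flow (Edge.src (edge i)) x))) →
         (∀ x → w′ x ≡ update (timedReset i x) (w x + t′ * ι 1ℚ)) →
         Rel (Edge.tgt (edge i) , v′) (tagged (Edge.tgt (edge i)) (assignmentAfter i J) , w′)
  related-after-edge i J 0≤w 0≤t′ matches v′≡ w′≡ = assignmentAfter i J , refl , λ x →
    retrack (sym (offset-after i J x)) (sym (v′≡ x)) (sym (w′≡ x))
      (Tracks-jump (Edge.rst (edge i) x) (flow-kept i x) (matches x) (delayed-nonNeg (0≤w x) 0≤t′))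

  source-step⇒timed-step : ∀ {p q} → Rel p q → ∀ {m p′} → Step GS p m p′ →
                 Σ (Game.Action GT × ℝ) λ m′ → Σ (Config GT) λ q′ → Step GT q m′ q′ × Rel p′ q′
  source-step⇒timed-step {_ , v} {_ , w} (J , refl , tracks) {_ , t} {_}
                         (0≤t , _ , e∈ , refl , refl , refl , fires)
    with Any.index e∈ | lookup-index e∈
  ... | i | refl
    with source-delay⇒timed-delay (Edge.src (edge i)) (Edge.guard (edge i)) J tracks 0≤t (proj₁ ∘ assocˡ′ ∘ fires)
  ... | t′ , 0≤t′ , holds , matches =
    (Edge.act (edge i) , t′) ,
    (tagged (Edge.tgt (edge i)) (assignmentAfter i J) , λ x → update (timedReset i x) (w x + t′ * ι 1ℚ)) ,
    (0≤t′ , timedEdge i J , timedEdge∈ i J , refl , refl , refl , λ x → assocʳ′ (holds x , refl)) ,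
    related-after-edge i J (Tracks.clock-nonNeg ∘ tracks) 0≤t′ matches (proj₂ ∘ proj₂ ∘ fires) (λ _ → refl)

  timed-step⇒source-step : ∀ {p q} → Rel p q → ∀ {m′ q′} → Step GT q m′ q′ →
                  Σ (Action × ℝ) λ m → Σ (Config GS) λ p′ → Step GS p m p′ × Rel p′ q′
  timed-step⇒source-step {_ , v} {_ , w} (J , refl , tracks) {_ , t′} {_}
                         (0≤t′ , _ , e∈ , src≡ , refl , refl , fires)
    with ∈timedEdges e∈
  ... | i , _ , refl with tagged-injective src≡
  ... | refl , refl
    with timed-delay⇒source-delay (Edge.src (edge i)) (Edge.guard (edge i)) J tracks _ 0≤t′ (proj₁ ∘ assocˡ′ ∘ fires)
  ... | holds , matches =
    (Edge.act (edge i) , t′) ,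
    (Edge.tgt (edge i) , λ x → update (Edge.rst (edge i) x) (v x + t′ * ι (flow (Edge.src (edge i)) x))) ,
    (0≤t′ , edge i , ∈-lookup i , refl , refl , refl , λ x → assocʳ′ (holds x , refl)) ,
    related-after-edge i J (Tracks.clock-nonNeg ∘ tracks) 0≤t′ matches (λ _ → refl) (proj₂ ∘ proj₂ ∘ fires)

  isSimulation : IsSimulation GS GT Rel
  isSimulation (l , _) _ rel@(J , refl , _) =
    sym (owner-tagged l J) , sym (cong lbl (untag-tagged l J)) ,
    (λ _ m p′ → source-step⇒timed-step rel {m} {p′}) , (λ _ m′ q′ → timed-step⇒source-step rel {m′} {q′})

  isSimulation⁻¹ : IsSimulation GT GS (flip Rel)
  isSimulation⁻¹ _ (l , _) rel@(J , refl , _) =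
    owner-tagged l J , cong lbl (untag-tagged l J) ,
    (λ _ m′ q′ → timed-step⇒source-step rel {m′} {q′}) , (λ _ m p′ → source-step⇒timed-step rel {m} {p′})

  related-initial : Rel (initial GS) (initial GT)
  related-initial = initialAssignment , refl , λ x →
    retrack (sym (offset-initial x)) ι-0 ι-0 (Tracks-reset (flow (inj₁ l₀) x) 0ℚ)

mainTheorem7 : (R : CompleteOrderedField) → ∀ {o : ℕ} (GS : Game o) →
    Σ (Game o) λ GT → IsTimed GT ×
      Σ (Semantics.Config R GS → Semantics.Config R GT → Set) λ Rel →
        Semantics.Witnesses R GS GT Rel × Semantics.Witnesses R GT GS (flip Rel)
mainTheorem7 R GS = GT , GT-isTimed , Rel , (isSimulation , related-initial) , (isSimulation⁻¹ , related-initial)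
  where
  open TimedGame GS
  open Bisimulation R GS
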